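{- Let $\alpha,\alpha'\in\mathcal{C}_n$ with $\alpha'_i\leqslant\alpha_i$ for all $i\in[n-1]$. Then $\alpha'\leqslant_A\alpha$.
   Context: $[n]=\{1,\dots,n\}$. A (weak) composition is a finite sequence of nonnegative integers $(\alpha_1,\dots,\alpha_m)$ with $\alpha_k=0$ for $k>m$; $|\alpha|=\sum\alpha_k$. $\mathcal{C}_n$ is the set of compositions $(\alpha_1,\dots,\alpha_{n-1})$ with $0\leqslant\alpha_i\leqslant n-i$. For a composition $\alpha$, a positive integer $i$ and $j\in\mathbb{N}$: $c_{i,j}(\alpha)=0$ if $j\leqslant i+1$; for $j>i+1$, $c_{i,j}(\alpha)=c_{i,j-1}(\alpha)+1$ if $\alpha_{j-1}<\alpha_i-c_{i,j-1}(\alpha)$ and $c_{i,j}(\alpha)=c_{i,j-1}(\alpha)$ otherwise. For compositions with $|\alpha|=|\alpha'|+1$, $\alpha$ covers $\alpha'$ if there are positive integers $i<j$ with: (a1) $\alpha'_i\leqslant\alpha_i-1$; (a2) $\alpha'_j=\alpha_j+\alpha_i-\alpha'_i-1$; (a3) $\alpha'_k=\alpha_k$ for $k\neq i,j$; (a4) $c_{i,j}(\alpha)=c_{i,j}(\alpha')=\alpha'_i-\alpha_j$. The partial order $\leqslant_A$ on $\mathcal{C}_n$ is the reflexive-transitive closure of this covering relation on $\mathcal{C}_n$: $\beta\leqslant_A\alpha$ iff there is a chain $\beta=\gamma_0,\dots,\gamma_r=\alpha$ in $\mathcal{C}_n$ with $\gamma_{t+1}$ covering $\gamma_t$ for all $t$.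 -}

module Defs where

open import Data.Nat using (ℕ; zero; suc; _+_; _∸_; _≤_; _<_; _≤?_; _<?_)
open import Data.List using (List; []; _∷_; length)
open import Data.Nat.ListAction using (sum)
open import Data.Product using (Σ; _×_; ∃₂)
open import Data.Bool using (if_then_else_)
open import Relation.Nullary using (¬_; does)
open import Relation.Binary.PropositionalEquality using (_≡_)
open import Relation.Binary.Construct.Closure.ReflexiveTransitive using (Star)

-- A (weak) composition is a finite list of naturals; entries beyond the list are 0.
Composition : Set
Composition = List ℕ

-- 1-indexed entry α_k (α_k = 0 for k beyond the length; index 0 unused, = 0).
at : Composition → ℕ → ℕ
at []       _             = 0
at (x ∷ xs) zero          = 0
at (x ∷ xs) (suc zero)    = x
at (x ∷ xs) (suc (suc k)) = at xs (suc k)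

size : Composition → ℕ
size = sum

InC : ℕ → Composition → Set
InC n α = (length α ≡ n ∸ 1) × (∀ i → 1 ≤ i → i ≤ n ∸ 1 → at α i ≤ n ∸ i)

-- c_{i,j}(α): 0 if j ≤ i+1; otherwise c_{i,j-1}+1 if α_{j-1} < α_i - c_{i,j-1}, else c_{i,j-1}.
-- (Truncated subtraction is harmless: if c > α_i the integer condition is false, as is α_{j-1} < 0.)
c : Composition → ℕ → ℕ → ℕ
c α i zero    = 0
c α i (suc j) =
  if does (suc j ≤? suc i) then 0
  else (if does (at α j <? (at α i ∸ c α i j)) then suc (c α i j) else c α i j)

Covers : Composition → Composition → Set
Covers α α' =
  (size α ≡ suc (size α')) ×
  ∃₂ λ i j → (1 ≤ i) × (i < j) ×
    (at α' i + 1 ≤ at α i) ×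
    (at α' j + at α' i + 1 ≡ at α j + at α i) ×                -- (a2), α'_j = α_j + α_i - α'_i - 1
    (∀ k → ¬ (k ≡ i) → ¬ (k ≡ j) → at α' k ≡ at α k) ×
    (c α i j ≡ c α' i j) × (c α i j + at α j ≡ at α' i)        -- (a4), c = α'_i - α_j

CoverStepIn : ℕ → Composition → Composition → Set
CoverStepIn n β γ = InC n β × InC n γ × Covers γ β

_≤A[_]_ : Composition → ℕ → Composition → Set
β ≤A[ n ] α = Star (CoverStepIn n) β α

{-# OPTIONS --safe #-}
-- Lowering one positive entry of a composition in C_n by 1 always gives a composition it covers
-- (the second index j of the covering can be found by following the recursion for c_{i,j}),
-- and C_n is closed under such lowerings.  If α′ ≤ α entrywise, α is lowered to α′ one unit at a
-- time, and the resulting chain of coverings stays inside C_n.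
module Submission where

open import Defs
open import Data.Bool using (if_then_else_)
open import Data.List using ([]; _∷_; length)
open import Data.List.Relation.Binary.Pointwise using (Pointwise; []; _∷_)
open import Data.Nat using (ℕ; zero; suc; _+_; _∸_; _≤_; _<_; _≤′_; _≟_; _≤?_; _<?_; z≤n; s≤s)
open import Data.Nat.Base using (≤′-refl; ≤′-step)
open import Data.Nat.Induction using (<-wellFounded)
open import Data.Nat.Properties
open import Data.Product using (∃; _×_; _,_; proj₁; proj₂)
open import Function using (_∘_)
open import Induction.WellFounded using (Acc; acc)
open import Relation.Binary.Construct.Closure.ReflexiveTransitive using (Star; ε; _◅_; _◅◅_; gmap)
open import Relation.Binary.Definitions using (tri<; tri≈; tri>)
open import Relation.Binary.PropositionalEquality
open import Relation.Nullary using (does; yes; no; contradiction)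
open import Relation.Nullary.Decidable using (dec-true; dec-false)

at-beyond-length : ∀ α k → length α < k → at α k ≡ 0
at-beyond-length []       k             _         = refl
at-beyond-length (x ∷ xs) zero          _         = refl
at-beyond-length (x ∷ xs) (suc zero)    (s≤s ())
at-beyond-length (x ∷ xs) (suc (suc k)) (s≤s lt) = at-beyond-length xs (suc k) lt

m<o∸n⇒m+n<o : ∀ m n o → m < o ∸ n → m + n < o
m<o∸n⇒m+n<o m n o lt =
  ≰⇒> λ o≤m+n → <⇒≱ lt (m≤n+o⇒m∸n≤o o n (≤-trans o≤m+n (≤-reflexive (+-comm m n))))

c-start : ∀ α i → c α i (suc i) ≡ 0
c-start α i rewrite dec-true (suc i ≤? suc i) ≤-refl = refl

c-suc : ∀ α {i j} → i < j →
        c α i (suc j) ≡ (if does (at α j <? at α i ∸ c α i j) then suc (c α i j) else c α i j)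
c-suc α {i} {j} i<j rewrite dec-false (suc j ≤? suc i) (<⇒≱ (s≤s i<j)) = refl

c-suc-< : ∀ α {i j} → i < j → at α j + c α i j < at α i → c α i (suc j) ≡ suc (c α i j)
c-suc-< α {i} {j} i<j below
  rewrite c-suc α i<j
        | dec-true (at α j <? at α i ∸ c α i j) (m+n≤o⇒m≤o∸n (suc (at α j)) below) = refl

c-suc-≥ : ∀ α {i j} → i < j → at α i ≤ at α j + c α i j → c α i (suc j) ≡ c α i j
c-suc-≥ α {i} {j} i<j above
  rewrite c-suc α i<j
        | dec-false (at α j <? at α i ∸ c α i j) (λ lt → <⇒≱ (m<o∸n⇒m+n<o _ _ _ lt) above) = refl

data Decrement : Composition → Composition → Set where
  here  : ∀ {x xs}    → Decrement (x ∷ xs) (suc x ∷ xs)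
  there : ∀ {x xs ys} → Decrement xs ys → Decrement (x ∷ xs) (x ∷ ys)

-- Entries are 1-indexed, so the decremented entry of  d  is  at _ (suc (position d)).
position : ∀ {β γ} → Decrement β γ → ℕ
position here      = 0
position (there d) = suc (position d)

at-position : ∀ {β γ} (d : Decrement β γ) → at γ (suc (position d)) ≡ suc (at β (suc (position d)))
at-position here      = refl
at-position (there d) = at-position d

at-elsewhere : ∀ {β γ} (d : Decrement β γ) k → k ≢ suc (position d) → at β k ≡ at γ k
at-elsewhere here      zero          _  = refl
at-elsewhere here      (suc zero)    k≢ = contradiction refl k≢
at-elsewhere here      (suc (suc k)) _  = refl
at-elsewhere (there d) zero          _  = refl
at-elsewhere (there d) (suc zero)    _  = refl
at-elsewhere (there d) (suc (suc k)) k≢ = at-elsewhere d (suc k) (k≢ ∘ cong suc)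

at-decrement-≤ : ∀ {β γ} → Decrement β γ → ∀ k → at β k ≤ at γ k
at-decrement-≤ d k with k ≟ suc (position d)
... | yes refl = ≤-trans (n≤1+n _) (≤-reflexive (sym (at-position d)))
... | no k≢    = ≤-reflexive (at-elsewhere d k k≢)

size-decrement : ∀ {β γ} → Decrement β γ → size γ ≡ suc (size β)
size-decrement here                = refl
size-decrement (there {x = x} d) = trans (cong (x +_) (size-decrement d)) (+-suc x _)

length-decrement : ∀ {β γ} → Decrement β γ → length β ≡ length γ
length-decrement here      = refl
length-decrement (there d) = cong suc (length-decrement d)

InC-decrement : ∀ {n β γ} → InC n γ → Decrement β γ → InC n β
InC-decrement (len , bounded) d =
  trans (length-decrement d) len , λ k 1≤k k≤ → ≤-trans (at-decrement-≤ d k) (bounded k 1≤k k≤)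

-- The partner index of the covering is the first j > i with γ_j + c_{i,j}(γ) = γ_i − 1.  Before
-- that j the recursions for c_{i,j} on γ and on β make the same choices, and j exists because
-- c_{i,j}(γ) stays ≤ γ_i − 1 while γ_j = 0 beyond the length of γ.
module _ {β γ : Composition} (d : Decrement β γ) where
  private
    i b : ℕ
    i = suc (position d)
    b = at β i

    at-β-after : ∀ {j} → i < j → at β j ≡ at γ j
    at-β-after i<j = at-elsewhere d _ (<⇒≢ i<j ∘ sym)

    measure : ℕ → ℕ
    measure j = (suc (length γ) ∸ j) + (b ∸ c γ i j)

    Partner : Set
    Partner = ∃ λ j → i < j × c γ i j ≡ c β i j × at γ j + c γ i j ≡ b

    both-increment : ∀ {j} → i < j → c γ i j ≡ c β i j → at γ j + c γ i j < b →
                     c γ i (suc j) ≡ suc (c γ i j) × c β i (suc j) ≡ suc (c β i j)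
    both-increment {j} i<j agree below =
      c-suc-< γ i<j (subst (at γ j + c γ i j <_) (sym (at-position d)) (m<n⇒m<1+n below)) ,
      c-suc-< β i<j (subst₂ (λ u v → u + v < b) (sym (at-β-after i<j)) agree below)

    both-constant : ∀ {j} → i < j → c γ i j ≡ c β i j → b < at γ j + c γ i j →
                    c γ i (suc j) ≡ c γ i j × c β i (suc j) ≡ c β i j
    both-constant {j} i<j agree above =
      c-suc-≥ γ i<j (subst (_≤ at γ j + c γ i j) (sym (at-position d)) above) ,
      c-suc-≥ β i<j (subst₂ (λ u v → b ≤ u + v) (sym (at-β-after i<j)) agree (<⇒≤ above))

    search : ∀ j → Acc _<_ (measure j) → i < j → c γ i j ≡ c β i j → c γ i j ≤ b → Partner
    search j (acc descend) i<j agree bounded with <-cmp (at γ j + c γ i j) b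
    ... | tri≈ _ hit _ = j , i<j , agree , hit
    ... | tri< below _ _ =
      search (suc j) (descend decreasing) (m<n⇒m<1+n i<j)
             (trans γ↑ (trans (cong suc agree) (sym β↑))) (subst (_≤ b) (sym γ↑) bounded′)
      where
      γ↑ = proj₁ (both-increment i<j agree below)
      β↑ = proj₂ (both-increment i<j agree below)
      bounded′ : suc (c γ i j) ≤ b
      bounded′ = ≤-trans (s≤s (m≤n+m _ _)) below
      decreasing : measure (suc j) < measure j
      decreasing rewrite γ↑ =
        +-mono-≤-< (∸-monoʳ-≤ (suc (length γ)) (n≤1+n j)) (∸-monoʳ-< ≤-refl bounded′)
    ... | tri> _ _ above =
      search (suc j) (descend decreasing) (m<n⇒m<1+n i<j)
             (trans γ→ (trans agree (sym β→))) (subst (_≤ b) (sym γ→) bounded)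
      where
      γ→ = proj₁ (both-constant i<j agree above)
      β→ = proj₂ (both-constant i<j agree above)
      within : j ≤ length γ
      within = ≮⇒≥ λ beyond →
        <⇒≱ above (subst (λ a → a + c γ i j ≤ b) (sym (at-beyond-length γ j beyond)) bounded)
      decreasing : measure (suc j) < measure j
      decreasing rewrite γ→ = +-mono-<-≤ (∸-monoʳ-< ≤-refl (s≤s within)) ≤-refl

  decrement-covers : Covers γ β
  decrement-covers with search (suc i) (<-wellFounded _) ≤-refl
                              (trans (c-start γ i) (sym (c-start β i)))
                              (subst (_≤ b) (sym (c-start γ i)) z≤n)
  ... | j , i<j , agree , hit =
    size-decrement d , i , j , s≤s z≤n , i<j , a1 , a2 , a3 , agree , trans (+-comm (c γ i j) (at γ j)) hit
    where
    at-β-i+1 : at β i + 1 ≡ at γ i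
    at-β-i+1 = trans (+-comm _ 1) (sym (at-position d))
    a1 : at β i + 1 ≤ at γ i
    a1 = ≤-reflexive at-β-i+1
    a2 : at β j + at β i + 1 ≡ at γ j + at γ i
    a2 = trans (+-assoc (at β j) _ 1) (cong₂ _+_ (at-β-after i<j) at-β-i+1)
    a3 : ∀ k → k ≢ i → k ≢ j → at β k ≡ at γ k
    a3 k k≢i _ = at-elsewhere d k k≢i

head-decrements : ∀ {x y} xs → x ≤′ y → Star Decrement (x ∷ xs) (y ∷ xs)
head-decrements xs ≤′-refl       = ε
head-decrements xs (≤′-step x≤y) = head-decrements xs x≤y ◅◅ here ◅ ε

pointwise⇒decrements : ∀ {β γ} → Pointwise _≤_ β γ → Star Decrement β γ
pointwise⇒decrements []                      = ε
pointwise⇒decrements {x ∷ xs} (x≤y ∷ xs≤ys) =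
  head-decrements xs (≤⇒≤′ x≤y) ◅◅ gmap (_ ∷_) there (pointwise⇒decrements xs≤ys)

at-≤⇒pointwise : ∀ β γ → length β ≡ length γ →
                 (∀ i → 1 ≤ i → i ≤ length γ → at β i ≤ at γ i) → Pointwise _≤_ β γ
at-≤⇒pointwise []       []       _   _   = []
at-≤⇒pointwise (x ∷ xs) (y ∷ ys) len ≤at =
  ≤at 1 (s≤s z≤n) (s≤s z≤n) ∷
  at-≤⇒pointwise xs ys (suc-injective len)
    λ { (suc i) _ i≤ → ≤at (suc (suc i)) (s≤s z≤n) (s≤s i≤) }

InC-decrements : ∀ {n β γ} → InC n γ → Star Decrement β γ → InC n β
InC-decrements inC ε        = inC
InC-decrements inC (d ◅ ds) = InC-decrement (InC-decrements inC ds) d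

decrements⇒≤A : ∀ {n β γ} → InC n γ → Star Decrement β γ → β ≤A[ n ] γ
decrements⇒≤A inC ε        = ε
decrements⇒≤A inC (d ◅ ds) =
  (InC-decrements inC (d ◅ ds) , InC-decrements inC ds , decrement-covers d) ◅ decrements⇒≤A inC ds

corollary3p6 : (n : ℕ) (α α′ : Composition) → InC n α → InC n α′ →
    (∀ i → 1 ≤ i → i ≤ n ∸ 1 → at α′ i ≤ at α i) →
    α′ ≤A[ n ] α
corollary3p6 n α α′ inCα@(lenα , _) (lenα′ , _) α′≤α =
  decrements⇒≤A inCα
    (pointwise⇒decrements (at-≤⇒pointwise α′ α (trans lenα′ (sym lenα)) entrywise))
  where
  entrywise : ∀ i → 1 ≤ i → i ≤ length α → at α′ i ≤ at α i
  entrywise i 1≤i i≤ = α′≤α i 1≤i (subst (i ≤_) lenα i≤)
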